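{- In the setting below, let $e\in U$ be an element that is added to $S$ when processed by Streaming-Greedy$(\alpha,\beta)$. Then \[\delta_e\ge\alpha+\beta\sum_{c\in C_e}\nu(f,S_e^-,c).\]
   Context: Setting: $N$ finite ground set with a $p$-matchoid: matroids $M_\ell=(N_\ell,\mathcal{I}_\ell)$, $\ell=1,\dots,q$, $N=\bigcup_\ell N_\ell$, each $e\in N$ in at most $p$ of the $N_\ell$, $\mathcal{I}=\{S\subseteq N:S\cap N_\ell\in\mathcal{I}_\ell\ \forall\ell\}$. $f:2^N\to\mathbb{R}_{\ge0}$ nonnegative submodular; $f_A(e)=f(A\cup\{e\})-f(A)$, $f_A(B)=f(A\cup B)-f(A)$. Elements arrive in a stream; $N$ is ordered by arrival. Incremental value: $\nu(f,S,e)=f_{S'}(e)$ with $S'=\{s\in S:s<e\}$ (for any set function $g$, $\nu(g,S,e)$ is defined analogously). Exchange-Candidates$(S,e)$: $C=\emptyset$; for each $\ell$ with $e\in N_\ell$ and $(S\cup\{e\})\cap N_\ell\notin\mathcal{I}_\ell$, let $S_\ell=S\cap N_\ell$, $X=\{s\in S_\ell:(S_\ell\setminus\{s\})\cup\{e\}\in\mathcal{I}_\ell\}$, add to $C$ an element $c_\ell\in X$ minimizing $\nu(f,S,\cdot)$; return $C$. Streaming-Greedy$(\alpha,\beta)$ with parameters $\alpha,\beta\ge0$: $S=\emptyset$; for each arriving $e$: $C=$Exchange-Candidates$(S,e)$; if $f_S(e)\ge\alpha+(1+\beta)\sum_{c\in C}\nu(f,S,c)$ then $S\leftarrow(S\setminus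 C)\cup\{e\}$, else $e$ is rejected. Notation: $S_e^-$ and $S_e^+$ are the values of $S$ just before and just after $e$ is processed; $U=\bigcup_{e}S_e^+$ is the set of all elements ever added to $S$; $C_e=$Exchange-Candidates$(S_e^-,e)$; $\delta_e=f(S_e^+)-f(S_e^-)$. -}

module Defs where

open import Level using (0ℓ)
open import Data.Nat using (ℕ; zero; suc)
import Data.Nat as ℕ
open import Data.Bool using (Bool; true; false; _∧_)
open import Data.Fin using (Fin; zero; suc; inject₁; _<?_)
open import Data.Fin.Subset using (Subset; _∈_; _∉_; _⊆_; _∪_; _∩_; _─_; ⁅_⁆; ⊥; inside; outside; ∣_∣)
open import Data.Fin.Subset.Properties using () renaming (_∈?_ to ∈?)
open import Data.Vec using (Vec; []; _∷_; tabulate; lookup)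
open import Data.List using (List; filter; length; allFin)
open import Data.Product using (Σ; _×_; ∃; _,_)
open import Data.Sum using (_⊎_)
open import Relation.Nullary using (¬_; does)
open import Relation.Binary.PropositionalEquality using (_≡_)
open import Relation.Binary.Structures using (IsTotalOrder)
open import Algebra.Structures using (IsCommutativeRing)

-- Totally ordered commutative rings (ℝ is an instance).  Values of f,
-- α, β live in such a ring.

record OrderedCommRing : Set₁ where
  infixl 7 _*_
  infixl 6 _+_ _-_
  infix 4 _≤_
  field
    Carrier : Set
    _+_ _*_ : Carrier → Carrier → Carrier
    -_ : Carrier → Carrier
    0# 1# : Carrier
    _≤_ : Carrier → Carrier → Set
    isCommutativeRing : IsCommutativeRing _≡_ _+_ _*_ -_ 0# 1#
    isTotalOrder : IsTotalOrder _≡_ _≤_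
    +-monoˡ-≤ : ∀ {x y} z → x ≤ y → x + z ≤ y + z
    *-nonneg : ∀ {x y} → 0# ≤ x → 0# ≤ y → 0# ≤ x * y
  _-_ : Carrier → Carrier → Carrier
  x - y = x + (- y)

-- Sets over the ground set N = Fin n (the order of Fin n is the arrival order).

below : ∀ {n} → Subset n → Fin n → Subset n
below S e = tabulate (λ i → lookup S i ∧ does (i <? e))

sumOver : ∀ {n} (R : OrderedCommRing) → Subset n → (Fin n → OrderedCommRing.Carrier R) → OrderedCommRing.Carrier R
sumOver R [] g = OrderedCommRing.0# R
sumOver R (inside ∷ A) g = OrderedCommRing._+_ R (g zero) (sumOver R A (λ i → g (suc i)))
sumOver R (outside ∷ A) g = sumOver R A (λ i → g (suc i))

record Matroid (n : ℕ) : Set₁ where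
  field
    ground : Subset n
    Indep  : Subset n → Set
    indep-⊆-ground : ∀ {A} → Indep A → A ⊆ ground
    indep-∅ : Indep ⊥
    indep-down : ∀ {A B} → A ⊆ B → Indep B → Indep A
    indep-aug : ∀ {A B} → Indep A → Indep B →
                ∣ A ∣ ℕ.< ∣ B ∣ →
                ∃ λ x → x ∈ B × x ∉ A × Indep (A ∪ ⁅ x ⁆)

record Matchoid (n p : ℕ) : Set₁ where
  field
    q : ℕ
    M : Fin q → Matroid n
    covers : ∀ (e : Fin n) → ∃ λ ℓ → e ∈ Matroid.ground (M ℓ)
    atMost-p : ∀ (e : Fin n) →
      length (filter (λ ℓ → ∈? e (Matroid.ground (M ℓ))) (allFin q)) ℕ.≤ p

module SetFun {n : ℕ} (R : OrderedCommRing) where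
  open OrderedCommRing R

  Nonneg : (Subset n → Carrier) → Set
  Nonneg f = ∀ A → 0# ≤ f A

  Submodular : (Subset n → Carrier) → Set
  Submodular f = ∀ A B → f (A ∪ B) + f (A ∩ B) ≤ f A + f B

  marg : (Subset n → Carrier) → Subset n → Fin n → Carrier
  marg f A e = f (A ∪ ⁅ e ⁆) - f A

  ν : (Subset n → Carrier) → Subset n → Fin n → Carrier
  ν f S e = marg f (below S e) e

-- Streaming-Greedy(α,β), with ties in Exchange-Candidates resolved
-- arbitrarily (relational description).

module Greedy {n p : ℕ} (R : OrderedCommRing) (𝓜 : Matchoid n p)
              (f : Subset n → OrderedCommRing.Carrier R)
              (α β : OrderedCommRing.Carrier R) where
  open OrderedCommRing R
  open SetFun {n} R
  open Matchoid 𝓜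

  Conflict : Subset n → Fin n → Fin q → Set
  Conflict S e ℓ = e ∈ Matroid.ground (M ℓ) ×
                   ¬ Matroid.Indep (M ℓ) ((S ∪ ⁅ e ⁆) ∩ Matroid.ground (M ℓ))

  InX : Subset n → Fin n → Fin q → Fin n → Set
  InX S e ℓ s = s ∈ (S ∩ Matroid.ground (M ℓ)) ×
                Matroid.Indep (M ℓ) (((S ∩ Matroid.ground (M ℓ)) ─ ⁅ s ⁆) ∪ ⁅ e ⁆)

  IsExchangeCandidates : Subset n → Fin n → Subset n → Set
  IsExchangeCandidates S e C =
    Σ (Fin q → Fin n) λ c →
      (∀ ℓ → Conflict S e ℓ →
         InX S e ℓ (c ℓ) × (∀ s → InX S e ℓ s → ν f S (c ℓ) ≤ ν f S s)) ×
      (∀ x → x ∈ C → ∃ λ ℓ → Conflict S e ℓ × c ℓ ≡ x) ×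
      (∀ ℓ → Conflict S e ℓ → c ℓ ∈ C)

  Threshold : Subset n → Fin n → Subset n → Set
  Threshold S e C = α + (1# + β) * sumOver R C (ν f S) ≤ marg f S e

  Step : Subset n → Fin n → Subset n → Subset n → Set
  Step S⁻ e C S⁺ = IsExchangeCandidates S⁻ e C ×
    ((Threshold S⁻ e C × S⁺ ≡ (S⁻ ─ C) ∪ ⁅ e ⁆) ⊎ (¬ Threshold S⁻ e C × S⁺ ≡ S⁻))

  -- a run over the whole stream: state k = S after the first k elements;
  -- S_e^- = state (inject₁ e), S_e^+ = state (suc e), C_e = cand e.
  record Run : Set where
    field
      state : Fin (suc n) → Subset n
      cand  : Fin n → Subset n
      start : state zero ≡ ⊥
      step  : ∀ e → Step (state (inject₁ e)) e (cand e) (state (suc e))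

-- When e is accepted, S⁺ = (S⁻ ∖ C) ∪ {e}.  Re-inserting the candidates
-- c ∈ C into S⁺ one at a time in arrival order, each insertion costs at
-- most ν(f,S⁻,c) by submodularity, because every element of S⁻ that
-- precedes c is either already back or was never removed.  Hence
-- f(S⁻ ∪ {e}) ≤ f(S⁺) + Σ_C ν, and subtracting this from the acceptance
-- threshold f_{S⁻}(e) ≥ α + (1+β) Σ_C ν leaves δ_e ≥ α + β Σ_C ν.
module Submission where

open import Defs
open import Level using (0ℓ)
open import Algebra.Bundles using (CommutativeRing)
open import Data.Bool using (_∧_; T)
open import Data.Bool.Properties using (T-≡; T-∧)
open import Data.Fin using (Fin; zero; suc; toℕ; fromℕ; inject₁)
open import Data.Fin.Induction using (<-weakInduction)
open import Data.Fin.Properties using (toℕ-injective; toℕ-inject₁; toℕ-fromℕ; toℕ<n)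
open import Data.Fin.Subset
  using (Subset; _∈_; _∉_; _⊆_; _∪_; _∩_; _─_; ⁅_⁆; ⊥; inside; outside)
open import Data.Fin.Subset.Properties
  using (_∈?_; ⊆-antisym; ∉⊥; ∪-identityʳ; ∪-assoc; x∈⁅x⁆; x∈⁅y⁆⇒x≡y;
         x∈p∪q⁺; x∈p∪q⁻; x∈p∩q⁺; x∈p∩q⁻; x∈p∧x∉q⇒x∈p─q; p─q⊆p)
open import Data.Nat as ℕ using (ℕ)
import Data.Nat.Properties as ℕ
open import Data.Product using (_×_; _,_; proj₁; proj₂)
open import Data.Sum using (_⊎_; inj₁; inj₂)
open import Data.Vec using (_∷_; tabulate; lookup; here; there)
open import Data.Vec.Properties using (lookup∘tabulate; []=⇒lookup; lookup⇒[]=)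
open import Function using (_∘_)
open import Function.Bundles using (Equivalence)
open import Relation.Binary.Bundles using (Poset)
open import Relation.Binary.PropositionalEquality
  using (_≡_; refl; sym; trans; cong; subst; subst₂; module ≡-Reasoning)
open import Relation.Binary.Structures using (IsTotalOrder)
import Relation.Binary.Reasoning.PartialOrder as PosetReasoning
open import Relation.Nullary using (yes; no; contradiction)

module OrderedCommRingProperties (R : OrderedCommRing) where
  open OrderedCommRing R

  commutativeRing : CommutativeRing 0ℓ 0ℓ
  commutativeRing = record { isCommutativeRing = isCommutativeRing }

  open CommutativeRing commutativeRing public
    using (+-assoc; +-comm; +-identityʳ; -‿inverseʳ; distribʳ; *-identityˡ)

  ≤-poset : Poset 0ℓ 0ℓ 0ℓ
  ≤-poset = record { isPartialOrder = IsTotalOrder.isPartialOrder isTotalOrder }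

  module ≤-Reasoning = PosetReasoning ≤-poset

  x+y-y≡x : ∀ x y → x + y - y ≡ x
  x+y-y≡x x y = begin
    x + y + - y    ≡⟨ +-assoc x y (- y) ⟩
    x + (y + - y)  ≡⟨ cong (x +_) (-‿inverseʳ y) ⟩
    x + 0#         ≡⟨ +-identityʳ x ⟩
    x              ∎
    where open ≡-Reasoning

  x+y≤z⇒x≤z-y : ∀ {x y z} → x + y ≤ z → x ≤ z - y
  x+y≤z⇒x≤z-y {x} {y} h = subst (_≤ _) (x+y-y≡x x y) (+-monoˡ-≤ (- y) h)

  +-cancelʳ-≤ : ∀ {x y} z → x + z ≤ y + z → x ≤ y
  +-cancelʳ-≤ {y = y} z h = subst (_ ≤_) (x+y-y≡x y z) (x+y≤z⇒x≤z-y h)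

  a+b≤c+d⇒a≤d+[c-b] : ∀ {a b c d} → a + b ≤ c + d → a ≤ d + (c - b)
  a+b≤c+d⇒a≤d+[c-b] {b = b} {c} {d} h =
    subst (_ ≤_) (trans (cong (_- b) (+-comm c d)) (+-assoc d c (- b))) (x+y≤z⇒x≤z-y h)

  a+[1+b]s≤p-q⇒a+bs≤r-q : ∀ {a b s p q r} →
    a + (1# + b) * s ≤ p - q → p ≤ r + s → a + b * s ≤ r - q
  a+[1+b]s≤p-q⇒a+bs≤r-q {a} {b} {s} {p} {q} {r} threshold p≤r+s = +-cancelʳ-≤ s (begin
    a + b * s + s        ≡⟨ +-assoc a (b * s) s ⟩
    a + (b * s + s)      ≡⟨ cong (a +_) (+-comm (b * s) s) ⟩
    a + (s + b * s)      ≡⟨ cong (λ t → a + (t + b * s)) (sym (*-identityˡ s)) ⟩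
    a + (1# * s + b * s) ≡⟨ cong (a +_) (sym (distribʳ s 1# b)) ⟩
    a + (1# + b) * s     ≤⟨ threshold ⟩
    p - q                ≤⟨ +-monoˡ-≤ (- q) p≤r+s ⟩
    r + s + - q          ≡⟨ +-assoc r s (- q) ⟩
    r + (s + - q)        ≡⟨ cong (r +_) (+-comm s (- q)) ⟩
    r + (- q + s)        ≡⟨ +-assoc r (- q) s ⟨
    r - q + s            ∎)
    where open ≤-Reasoning

x∈p─q⇒x∉q : ∀ {n} (p q : Subset n) {x} → x ∈ p ─ q → x ∉ q
x∈p─q⇒x∉q (inside ∷ p) (outside ∷ q) here ()
x∈p─q⇒x∉q (_ ∷ p) (_ ∷ q) (there x∈p─q) (there x∈q) = x∈p─q⇒x∉q p q x∈p─q x∈q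

∈⇒T-lookup : ∀ {n} {p : Subset n} {x} → x ∈ p → T (lookup p x)
∈⇒T-lookup x∈p = Equivalence.from T-≡ ([]=⇒lookup x∈p)

T-lookup⇒∈ : ∀ {n} {p : Subset n} {x} → T (lookup p x) → x ∈ p
T-lookup⇒∈ {p = p} {x} t = lookup⇒[]= x p (Equivalence.to T-≡ t)

module _ {n : ℕ} where

  prefix : ℕ → Subset n → Subset n
  prefix k C = tabulate (λ i → lookup C i ∧ (toℕ i ℕ.<ᵇ k))

  lookup-prefix : ∀ k C (x : Fin n) → lookup (prefix k C) x ≡ lookup C x ∧ (toℕ x ℕ.<ᵇ k)
  lookup-prefix k C = lookup∘tabulate (λ i → lookup C i ∧ (toℕ i ℕ.<ᵇ k))

  ∈-prefix⁻ : ∀ k C {x} → x ∈ prefix k C → x ∈ C × toℕ x ℕ.< k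
  ∈-prefix⁻ k C {x} x∈P with Equivalence.to T-∧ (subst T (lookup-prefix k C x) (∈⇒T-lookup x∈P))
  ... | x∈C , x<k = T-lookup⇒∈ x∈C , ℕ.<ᵇ⇒< (toℕ x) k x<k

  ∈-prefix⁺ : ∀ k C {x} → x ∈ C → toℕ x ℕ.< k → x ∈ prefix k C
  ∈-prefix⁺ k C {x} x∈C x<k = T-lookup⇒∈
    (subst T (sym (lookup-prefix k C x)) (Equivalence.from T-∧ (∈⇒T-lookup x∈C , ℕ.<⇒<ᵇ x<k)))

  -- `below C c` is definitionally `prefix (toℕ c) C`.
  ∈-below⁻ : ∀ C c {x} → x ∈ below C c → x ∈ C × toℕ x ℕ.< toℕ c
  ∈-below⁻ C c = ∈-prefix⁻ (toℕ c) C

  ∉-below-self : ∀ C c → c ∉ below C c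
  ∉-below-self C c = ℕ.<-irrefl refl ∘ proj₂ ∘ ∈-below⁻ C c

  prefix-zero : ∀ C → prefix 0 C ≡ ⊥
  prefix-zero C = ⊆-antisym (λ x∈P → contradiction (proj₂ (∈-prefix⁻ 0 C x∈P)) ℕ.n≮0)
                            (λ x∈⊥ → contradiction x∈⊥ ∉⊥)

  prefix-full : ∀ C → prefix n C ≡ C
  prefix-full C = ⊆-antisym (proj₁ ∘ ∈-prefix⁻ n C) (λ {x} x∈C → ∈-prefix⁺ n C x∈C (toℕ<n x))

  prefix-mono : ∀ k C → prefix k C ⊆ prefix (ℕ.suc k) C
  prefix-mono k C x∈P = let x∈C , x<k = ∈-prefix⁻ k C x∈P in ∈-prefix⁺ (ℕ.suc k) C x∈C (ℕ.m<n⇒m<1+n x<k)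

  ∈-prefix-suc⁻ : ∀ C i {x} → x ∈ prefix (ℕ.suc (toℕ i)) C → x ∈ prefix (toℕ i) C ⊎ (x ≡ i × x ∈ C)
  ∈-prefix-suc⁻ C i x∈P with ∈-prefix⁻ (ℕ.suc (toℕ i)) C x∈P
  ... | x∈C , x≤i with ℕ.m<1+n⇒m<n∨m≡n x≤i
  ...   | inj₁ x<i = inj₁ (∈-prefix⁺ (toℕ i) C x∈C x<i)
  ...   | inj₂ x≡i = inj₂ (toℕ-injective x≡i , x∈C)

  prefix-suc-∈ : ∀ {C i} → i ∈ C → prefix (ℕ.suc (toℕ i)) C ≡ prefix (toℕ i) C ∪ ⁅ i ⁆
  prefix-suc-∈ {C} {i} i∈C = ⊆-antisym to from
    where
    to : prefix (ℕ.suc (toℕ i)) C ⊆ prefix (toℕ i) C ∪ ⁅ i ⁆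
    to x∈P with ∈-prefix-suc⁻ C i x∈P
    ... | inj₁ x∈P′ = x∈p∪q⁺ (inj₁ x∈P′)
    ... | inj₂ (refl , _) = x∈p∪q⁺ (inj₂ (x∈⁅x⁆ i))
    from : prefix (toℕ i) C ∪ ⁅ i ⁆ ⊆ prefix (ℕ.suc (toℕ i)) C
    from x∈P∪i with x∈p∪q⁻ (prefix (toℕ i) C) ⁅ i ⁆ x∈P∪i
    ... | inj₁ x∈P = prefix-mono (toℕ i) C x∈P
    ... | inj₂ x∈⁅i⁆ rewrite x∈⁅y⁆⇒x≡y i x∈⁅i⁆ = ∈-prefix⁺ (ℕ.suc (toℕ i)) C i∈C ℕ.≤-refl

  prefix-suc-∉ : ∀ {C i} → i ∉ C → prefix (ℕ.suc (toℕ i)) C ≡ prefix (toℕ i) C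
  prefix-suc-∉ {C} {i} i∉C = ⊆-antisym to (prefix-mono (toℕ i) C)
    where
    to : prefix (ℕ.suc (toℕ i)) C ⊆ prefix (toℕ i) C
    to x∈P with ∈-prefix-suc⁻ C i x∈P
    ... | inj₁ x∈P′ = x∈P′
    ... | inj₂ (refl , i∈C) = contradiction i∈C i∉C

  ∪-⁅⁆-∪-⊆ : ∀ {X Y : Subset n} {i} → X ⊆ Y → (X ∪ ⁅ i ⁆) ∪ Y ≡ Y ∪ ⁅ i ⁆
  ∪-⁅⁆-∪-⊆ {X} {Y} {i} X⊆Y = ⊆-antisym to from
    where
    to : (X ∪ ⁅ i ⁆) ∪ Y ⊆ Y ∪ ⁅ i ⁆
    to x∈ with x∈p∪q⁻ (X ∪ ⁅ i ⁆) Y x∈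
    ... | inj₂ x∈Y = x∈p∪q⁺ (inj₁ x∈Y)
    ... | inj₁ x∈X∪i with x∈p∪q⁻ X ⁅ i ⁆ x∈X∪i
    ...   | inj₁ x∈X = x∈p∪q⁺ (inj₁ (X⊆Y x∈X))
    ...   | inj₂ x∈i = x∈p∪q⁺ (inj₂ x∈i)
    from : Y ∪ ⁅ i ⁆ ⊆ (X ∪ ⁅ i ⁆) ∪ Y
    from x∈ with x∈p∪q⁻ Y ⁅ i ⁆ x∈
    ... | inj₁ x∈Y = x∈p∪q⁺ (inj₂ x∈Y)
    ... | inj₂ x∈i = x∈p∪q⁺ (inj₁ (x∈p∪q⁺ (inj₂ x∈i)))

  ∪-⁅⁆-∩-⊆ : ∀ {X Y : Subset n} {i} → X ⊆ Y → i ∉ Y → (X ∪ ⁅ i ⁆) ∩ Y ≡ X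
  ∪-⁅⁆-∩-⊆ {X} {Y} {i} X⊆Y i∉Y = ⊆-antisym to (λ x∈X → x∈p∩q⁺ (x∈p∪q⁺ (inj₁ x∈X) , X⊆Y x∈X))
    where
    to : (X ∪ ⁅ i ⁆) ∩ Y ⊆ X
    to x∈ with x∈p∩q⁻ (X ∪ ⁅ i ⁆) Y x∈
    ... | x∈X∪i , x∈Y with x∈p∪q⁻ X ⁅ i ⁆ x∈X∪i
    ...   | inj₁ x∈X = x∈X
    ...   | inj₂ x∈i rewrite x∈⁅y⁆⇒x≡y i x∈i = contradiction x∈Y i∉Y

module _ (R : OrderedCommRing) where
  open OrderedCommRing R
  open OrderedCommRingProperties R

  sumOver-⊥ : ∀ {n} (g : Fin n → Carrier) → sumOver R ⊥ g ≡ 0#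
  sumOver-⊥ {ℕ.zero} g = refl
  sumOver-⊥ {ℕ.suc n} g = sumOver-⊥ (g ∘ suc)

  sumOver-∪-⁅⁆ : ∀ {n} (X : Subset n) i (g : Fin n → Carrier) → i ∉ X →
    sumOver R (X ∪ ⁅ i ⁆) g ≡ g i + sumOver R X g
  sumOver-∪-⁅⁆ (outside ∷ X) zero g _ = cong (λ Y → g zero + sumOver R Y (g ∘ suc)) (∪-identityʳ X)
  sumOver-∪-⁅⁆ (inside ∷ X) zero g i∉X = contradiction here i∉X
  sumOver-∪-⁅⁆ (outside ∷ X) (suc i) g i∉X = sumOver-∪-⁅⁆ X i (g ∘ suc) (i∉X ∘ there)
  sumOver-∪-⁅⁆ (inside ∷ X) (suc i) g i∉X = begin
    g zero + sumOver R (X ∪ ⁅ i ⁆) (g ∘ suc) ≡⟨ cong (g zero +_) (sumOver-∪-⁅⁆ X i (g ∘ suc) (i∉X ∘ there)) ⟩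
    g zero + (g (suc i) + rest)              ≡⟨ +-assoc (g zero) (g (suc i)) rest ⟨
    g zero + g (suc i) + rest                ≡⟨ cong (_+ rest) (+-comm (g zero) (g (suc i))) ⟩
    g (suc i) + g zero + rest                ≡⟨ +-assoc (g (suc i)) (g zero) rest ⟩
    g (suc i) + (g zero + rest)              ∎
    where
    open ≡-Reasoning
    rest = sumOver R X (g ∘ suc)

  module _ {n : ℕ} (F : Subset n → Carrier) (g : Fin n → Carrier) (A C : Subset n)
    (marginal≤ : ∀ {c} → c ∈ C → F ((A ∪ below C c) ∪ ⁅ c ⁆) ≤ F (A ∪ below C c) + g c)
    where

    private
      Bound : ℕ → Set
      Bound k = F (A ∪ prefix k C) ≤ F A + sumOver R (prefix k C) g

    telescope-zero : Bound 0
    telescope-zero = begin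
      F (A ∪ prefix 0 C)           ≡⟨ cong (λ P → F (A ∪ P)) (prefix-zero C) ⟩
      F (A ∪ ⊥)                    ≡⟨ cong F (∪-identityʳ A) ⟩
      F A                          ≡⟨ +-identityʳ (F A) ⟨
      F A + 0#                     ≡⟨ cong (F A +_) (sumOver-⊥ g) ⟨
      F A + sumOver R ⊥ g          ≡⟨ cong (λ P → F A + sumOver R P g) (prefix-zero C) ⟨
      F A + sumOver R (prefix 0 C) g ∎
      where open ≤-Reasoning

    telescope-suc : ∀ i → Bound (toℕ i) → Bound (ℕ.suc (toℕ i))
    telescope-suc i bound with i ∈? C
    ... | no i∉C = subst (λ P → F (A ∪ P) ≤ F A + sumOver R P g) (sym (prefix-suc-∉ i∉C)) bound
    ... | yes i∈C = begin
      F (A ∪ prefix (ℕ.suc (toℕ i)) C)   ≡⟨ cong (λ Q → F (A ∪ Q)) (prefix-suc-∈ i∈C) ⟩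
      F (A ∪ (P ∪ ⁅ i ⁆))                ≡⟨ cong F (∪-assoc A P ⁅ i ⁆) ⟨
      F ((A ∪ P) ∪ ⁅ i ⁆)                ≤⟨ marginal≤ i∈C ⟩
      F (A ∪ P) + g i                    ≤⟨ +-monoˡ-≤ (g i) bound ⟩
      F A + sumOver R P g + g i          ≡⟨ +-assoc (F A) (sumOver R P g) (g i) ⟩
      F A + (sumOver R P g + g i)        ≡⟨ cong (F A +_) (+-comm (sumOver R P g) (g i)) ⟩
      F A + (g i + sumOver R P g)        ≡⟨ cong (F A +_) (sumOver-∪-⁅⁆ P i g (∉-below-self C i)) ⟨
      F A + sumOver R (P ∪ ⁅ i ⁆) g      ≡⟨ cong (λ Q → F A + sumOver R Q g) (prefix-suc-∈ i∈C) ⟨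
      F A + sumOver R (prefix (ℕ.suc (toℕ i)) C) g ∎
      where
      open ≤-Reasoning
      P = prefix (toℕ i) C

    telescope : F (A ∪ C) ≤ F A + sumOver R C g
    telescope = subst (λ P → F (A ∪ P) ≤ F A + sumOver R P g) (prefix-full C)
                      (subst Bound (toℕ-fromℕ n) (bounds (fromℕ n)))
      where
      bounds : ∀ k → Bound (toℕ k)
      bounds = <-weakInduction (Bound ∘ toℕ) telescope-zero
                 (λ i → telescope-suc i ∘ subst Bound (toℕ-inject₁ i))

  module _ {n : ℕ} (f : Subset n → Carrier) (submodular : SetFun.Submodular {n} R f) where
    open SetFun {n} R using (marg; ν)

    diminishing-returns : ∀ {X Y i} → X ⊆ Y → i ∉ Y → f (Y ∪ ⁅ i ⁆) ≤ f Y + marg f X i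
    diminishing-returns {X} {Y} {i} X⊆Y i∉Y = a+b≤c+d⇒a≤d+[c-b]
      (subst₂ (λ U V → f U + f V ≤ f (X ∪ ⁅ i ⁆) + f Y)
              (∪-⁅⁆-∪-⊆ X⊆Y) (∪-⁅⁆-∩-⊆ X⊆Y i∉Y) (submodular (X ∪ ⁅ i ⁆) Y))

    exchange-bound : ∀ {S e C} → C ⊆ S → e ∉ S →
      f (S ∪ ⁅ e ⁆) ≤ f ((S ─ C) ∪ ⁅ e ⁆) + sumOver R C (ν f S)
    exchange-bound {S} {e} {C} C⊆S e∉S =
      subst (λ U → f U ≤ f A + sumOver R C (ν f S)) reinsert
            (telescope f (ν f S) A C (λ {c} c∈C → diminishing-returns (below-⊆ c) (c∉A∪below c∈C)))
      where
      A = (S ─ C) ∪ ⁅ e ⁆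

      below-⊆ : ∀ c → below S c ⊆ A ∪ below C c
      below-⊆ c {x} x∈below with ∈-below⁻ S c x∈below | x ∈? C
      ... | _   , x<c | yes x∈C = x∈p∪q⁺ (inj₂ (∈-prefix⁺ (toℕ c) C x∈C x<c))
      ... | x∈S , _   | no x∉C  = x∈p∪q⁺ (inj₁ (x∈p∪q⁺ (inj₁ (x∈p∧x∉q⇒x∈p─q x∈S x∉C))))

      c∉A∪below : ∀ {c} → c ∈ C → c ∉ A ∪ below C c
      c∉A∪below {c} c∈C c∈ with x∈p∪q⁻ A (below C c) c∈
      ... | inj₂ c∈below = ∉-below-self C c c∈below
      ... | inj₁ c∈A with x∈p∪q⁻ (S ─ C) ⁅ e ⁆ c∈A
      ...   | inj₁ c∈S─C = x∈p─q⇒x∉q S C c∈S─C c∈C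
      ...   | inj₂ c∈⁅e⁆ = e∉S (subst (_∈ S) (x∈⁅y⁆⇒x≡y e c∈⁅e⁆) (C⊆S c∈C))

      reinsert : A ∪ C ≡ S ∪ ⁅ e ⁆
      reinsert = ⊆-antisym to from
        where
        to : A ∪ C ⊆ S ∪ ⁅ e ⁆
        to x∈ with x∈p∪q⁻ A C x∈
        ... | inj₂ x∈C = x∈p∪q⁺ (inj₁ (C⊆S x∈C))
        ... | inj₁ x∈A with x∈p∪q⁻ (S ─ C) ⁅ e ⁆ x∈A
        ...   | inj₁ x∈S─C = x∈p∪q⁺ (inj₁ (p─q⊆p S C x∈S─C))
        ...   | inj₂ x∈⁅e⁆ = x∈p∪q⁺ (inj₂ x∈⁅e⁆)
        from : S ∪ ⁅ e ⁆ ⊆ A ∪ C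
        from {x} x∈ with x∈p∪q⁻ S ⁅ e ⁆ x∈ | x ∈? C
        ... | _          | yes x∈C = x∈p∪q⁺ (inj₂ x∈C)
        ... | inj₁ x∈S   | no x∉C  = x∈p∪q⁺ (inj₁ (x∈p∪q⁺ (inj₁ (x∈p∧x∉q⇒x∈p─q x∈S x∉C))))
        ... | inj₂ x∈⁅e⁆ | no _    = x∈p∪q⁺ (inj₁ (x∈p∪q⁺ (inj₂ x∈⁅e⁆)))

module _ {n p : ℕ} (R : OrderedCommRing) (𝓜 : Matchoid n p)
         (f : Subset n → OrderedCommRing.Carrier R) (α β : OrderedCommRing.Carrier R) where
  open Greedy R 𝓜 f α β

  candidates-⊆ : ∀ {S e C} → IsExchangeCandidates S e C → C ⊆ S
  candidates-⊆ {S} (_ , chosen , C⊆chosen , _) x∈C with C⊆chosen _ x∈C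
  ... | ℓ , conflict , refl = proj₁ (x∈p∩q⁻ S _ (proj₁ (proj₁ (chosen ℓ conflict))))

  module _ (run : Run) where
    open Run run

    state-suc-⊆ : ∀ e → state (suc e) ⊆ state (inject₁ e) ∪ ⁅ e ⁆
    state-suc-⊆ e {i} i∈S⁺ with step e
    ... | _ , inj₂ (_ , S⁺≡S⁻) = x∈p∪q⁺ (inj₁ (subst (i ∈_) S⁺≡S⁻ i∈S⁺))
    ... | _ , inj₁ (_ , S⁺≡) with x∈p∪q⁻ _ ⁅ e ⁆ (subst (i ∈_) S⁺≡ i∈S⁺)
    ...   | inj₁ i∈S⁻─C = x∈p∪q⁺ (inj₁ (p─q⊆p _ _ i∈S⁻─C))
    ...   | inj₂ i∈⁅e⁆ = x∈p∪q⁺ (inj₂ i∈⁅e⁆)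

    state-precedes : ∀ k {i} → i ∈ state k → toℕ i ℕ.< toℕ k
    state-precedes = <-weakInduction (λ k → ∀ {i} → i ∈ state k → toℕ i ℕ.< toℕ k)
      (λ {i} i∈S → contradiction (subst (i ∈_) start i∈S) ∉⊥) step-precedes
      where
      step-precedes : ∀ e → (∀ {i} → i ∈ state (inject₁ e) → toℕ i ℕ.< toℕ (inject₁ e)) →
                      ∀ {i} → i ∈ state (suc e) → toℕ i ℕ.< ℕ.suc (toℕ e)
      step-precedes e precedes i∈S⁺ with x∈p∪q⁻ _ ⁅ e ⁆ (state-suc-⊆ e i∈S⁺)
      ... | inj₁ i∈S⁻ = ℕ.m<n⇒m<1+n (subst (_ ℕ.<_) (toℕ-inject₁ e) (precedes i∈S⁻))
      ... | inj₂ i∈⁅e⁆ rewrite x∈⁅y⁆⇒x≡y e i∈⁅e⁆ = ℕ.n<1+n (toℕ e)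

    arriving-∉-state : ∀ e → e ∉ state (inject₁ e)
    arriving-∉-state e e∈S⁻ = ℕ.<-irrefl (sym (toℕ-inject₁ e)) (state-precedes (inject₁ e) e∈S⁻)

mainTheorem5 : ∀ {n p : ℕ} (R : OrderedCommRing) (𝓜 : Matchoid n p)
  (f : Subset n → OrderedCommRing.Carrier R)
  (α β : OrderedCommRing.Carrier R) →
  OrderedCommRing._≤_ R (OrderedCommRing.0# R) α →
  OrderedCommRing._≤_ R (OrderedCommRing.0# R) β →
  SetFun.Nonneg {n} R f → SetFun.Submodular {n} R f →
  (run : Greedy.Run R 𝓜 f α β) →
  let open OrderedCommRing R
      open Greedy.Run run
  in (e : Fin n) → e ∈ state (suc e) →
     α + β * sumOver R (cand e) (SetFun.ν R f (state (inject₁ e)))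
       ≤ f (state (suc e)) - f (state (inject₁ e))
mainTheorem5 R 𝓜 f α β _ _ _ submodular run e e∈S⁺ with Greedy.Run.step run e
... | _ , inj₂ (_ , S⁺≡S⁻) =
  contradiction (subst (e ∈_) S⁺≡S⁻ e∈S⁺) (arriving-∉-state R 𝓜 f α β run e)
... | candidates , inj₁ (threshold , S⁺≡) rewrite S⁺≡ =
  OrderedCommRingProperties.a+[1+b]s≤p-q⇒a+bs≤r-q R threshold
    (exchange-bound R f submodular (candidates-⊆ R 𝓜 f α β candidates)
                    (arriving-∉-state R 𝓜 f α β run e))
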